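{- Let $E$ be a finite nonempty set, $f:2^E\to\mathbb{N}$ an integral polymatroid rank function, and $C_e:\mathbb{N}\times\mathbb{N}\to\mathbb{R}_+$ regular for each $e\in E$. Let $D\subset\mathbb{N}$ be a set of integers with $\mathbb{B}_f(d)\neq\emptyset$ for all $d\in D$, and for $\mathbf{t}\in\mathbb{N}^E$, $d\in D$ let $P(\mathbf{t},d)$ denote the problem of minimizing $\sum_{e\in E}C_e(x_e;t_e)$ over $\mathbf{x}\in\mathbb{B}_f(d)$. Then for every $d,d'\in D$, every $\mathbf{t},\mathbf{t}'\in\mathbb{N}^E$ and every optimal solution $\mathbf{x}^*(\mathbf{t},d)$ of $P(\mathbf{t},d)$, there is an optimal solution $\mathbf{x}^*(\mathbf{t}',d')$ of $P(\mathbf{t}',d')$ with $$\|\mathbf{x}^*(\mathbf{t},d)-\mathbf{x}^*(\mathbf{t}',d')\|_1\le 2\|\mathbf{t}-\mathbf{t}'\|_1+|d-d'|.$$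
   Context: An integral polymatroid rank function is a submodular, monotone, normalized ($f(\emptyset)=0$) set function $f:2^E\to\mathbb{N}$. $x(U)=\sum_{e\in U}x_e$; $\mathbb{B}_f(d)=\{\mathbf{x}\in\mathbb{N}^E: x(U)\le f(U)\ \forall U\subseteq E,\ x(E)=d\}$. $\|\cdot\|_1$ is the $L_1$-norm. For $C:\mathbb{N}\times\mathbb{N}\to\mathbb{R}$, $C^-(x;t)=C(x;t)-C(x-1;t)$ for $x\ge1$. $C$ is regular if $C^-(x;t)\le C^-(x;t+1)$ and $C^-(x;t+1)\le C^-(x+1;t)$ for all $x,t\in\mathbb{N}$ (where defined). -}

module Defs where

open import Level using (0ℓ)
open import Data.Bool using (Bool; true; false; if_then_else_)
open import Data.Nat using (ℕ; zero; suc; _+_; _*_; _≤_; ∣_-_∣)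
open import Data.Fin using (Fin; zero; suc)
open import Data.Fin.Subset using (Subset; ⊥; _⊆_; _∪_; _∩_)
open import Data.Vec using (lookup)
open import Data.Product using (Σ; _×_)
open import Relation.Binary.PropositionalEquality using (_≡_)
open import Algebra.Bundles using (AbelianGroup)
open import Relation.Binary.Structures using (IsTotalOrder)

-- Ground set E = Fin n (nonempty: n = suc m at the use site).

sumℕ : ∀ {n} → (Fin n → ℕ) → ℕ
sumℕ {zero}  g = 0
sumℕ {suc n} g = g zero + sumℕ (λ i → g (suc i))

x[_] : ∀ {n} → (Fin n → ℕ) → Subset n → ℕ
x[ x ] U = sumℕ (λ i → if lookup U i then x i else 0)

dist₁ : ∀ {n} → (Fin n → ℕ) → (Fin n → ℕ) → ℕ
dist₁ x y = sumℕ (λ i → ∣ x i - y i ∣)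

record IsPolymatroid {n : ℕ} (f : Subset n → ℕ) : Set where
  field
    normalized : f ⊥ ≡ 0
    monotone   : ∀ {U V} → U ⊆ V → f U ≤ f V
    submodular : ∀ U V → f (U ∪ V) + f (U ∩ V) ≤ f U + f V

InBase : ∀ {n} → (Subset n → ℕ) → ℕ → (Fin n → ℕ) → Set
InBase f d x = (∀ U → x[ x ] U ≤ f U) × x[ x ] Data.Fin.Subset.⊤ ≡ d

-- Cost values: the paper uses ℝ (costs in ℝ₊).  Agda's stdlib has no
-- reals, so we work over an arbitrary totally ordered abelian group
-- (ℝ with + and ≤ being one instance).

record OrderedAbelianGroup : Set₁ where
  field
    abGroup : AbelianGroup 0ℓ 0ℓ
  open AbelianGroup abGroup public
  field
    _≤ᵍ_         : Carrier → Carrier → Set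
    isTotalOrder : IsTotalOrder _≈_ _≤ᵍ_
    ∙-mono       : ∀ {x y} z → x ≤ᵍ y → (x ∙ z) ≤ᵍ (y ∙ z)

module _ (G : OrderedAbelianGroup) where
  open OrderedAbelianGroup G

  sumG : ∀ {n} → (Fin n → Carrier) → Carrier
  sumG {zero}  g = ε
  sumG {suc n} g = g zero ∙ sumG (λ i → g (suc i))

  -- Marginal cost: ΔC x t = C⁻(x+1; t) = C(x+1; t) - C(x; t)
  ΔC : (ℕ → ℕ → Carrier) → ℕ → ℕ → Carrier
  ΔC C x t = C (suc x) t ∙ (C x t) ⁻¹

  -- C is regular:  C⁻(x;t) ≤ C⁻(x;t+1)  and  C⁻(x;t+1) ≤ C⁻(x+1;t)
  -- for all x ≥ 1, t (i.e. wherever C⁻ is defined).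
  Regular : (ℕ → ℕ → Carrier) → Set
  Regular C = (∀ x t → ΔC C x t ≤ᵍ ΔC C x (suc t))
            × (∀ x t → ΔC C x (suc t) ≤ᵍ ΔC C (suc x) t)

  NonNeg : (ℕ → ℕ → Carrier) → Set
  NonNeg C = ∀ x t → ε ≤ᵍ C x t

  cost : ∀ {n} → (Fin n → ℕ → ℕ → Carrier) → (Fin n → ℕ) → (Fin n → ℕ) → Carrier
  cost C t x = sumG (λ e → C e (x e) (t e))

  Optimal : ∀ {n} → (Subset n → ℕ) → (Fin n → ℕ → ℕ → Carrier)
          → (Fin n → ℕ) → ℕ → (Fin n → ℕ) → Set
  Optimal f C t d x = InBase f d x × (∀ y → InBase f d y → cost C t x ≤ᵍ cost C t y)

module Submission where

-- A proximity bound is proved in the two monotone cases (t, d) ≤ (t′, d′) and (t, d) ≥ (t′, d′);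
-- the theorem follows by passing through (t ⊓ t′, d ⊓ d′).  In the monotone case, take any optimum z
-- of P(t′, d′).  If z is far from the optimum x of P(t, d), some coordinate i has
-- z_i + (t′_i − t_i) < x_i, and the simultaneous exchange property of polymatroids gives k with
-- x_k < z_k such that x − e_i + e_k and z + e_i − e_k are feasible.  Optimality of x and regularity
-- of the costs make z + e_i − e_k optimal as well, and it is closer to x by 2.  Iterating, the L1
-- distance drops to 2‖t − t′‖₁ + |d − d′|: then the coordinates where x exceeds z are paid for by
-- t′ − t, and those where z exceeds x by them plus d′ − d.
--
-- The exchange property comes from submodularity: if every candidate k were blocked by an x-tight
-- set or a z-tight set, the union of the former and the intersection of the latter would again be
-- tight, and comparing x and z on them contradicts x(E) ≤ z(E).

open import Defs

open import Level using (0ℓ)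
open import Function using (_∘_; id)
open import Data.Bool using (true; false; if_then_else_; _∨_; _∧_)
open import Data.Bool.Properties using (∨-zeroʳ; ∧-zeroʳ)
open import Data.Empty using (⊥-elim)
open import Data.Product using (Σ; ∃; ∃₂; _×_; _,_; proj₁; proj₂)
open import Data.Sum as ⊎ using (_⊎_; inj₁; inj₂)
open import Data.Nat using (ℕ; zero; suc; pred; >-nonZero; _≤′_; ≤′-refl; ≤′-step; _+_; _*_; _∸_; _⊓_; ∣_-_∣;
                           _≟_; _≤_; _<_; _<?_; z≤n; s≤s; s≤s⁻¹; z<s)
open import Data.Nat.Properties
open import Data.Nat.Induction using (<-wellFounded)
open import Data.Nat.Tactic.RingSolver using (solve-∀)
open import Data.Fin using (Fin; zero; suc)
open import Data.Fin.Properties using (any?)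
open import Data.Fin.Subset using (Subset; ⊤; _∪_; _∩_) renaming (⊥ to ∅)
open import Data.Fin.Subset.Properties using (anySubset?; ∪-zeroˡ; ∩-identityˡ)
open import Data.Vec using (lookup)
open import Data.Vec.Properties using (lookup-zipWith; lookup-replicate)
open import Data.Vec.Functional as Vector using (Vector; updateAt)
open import Data.Vec.Functional.Properties using (updateAt-updateAt-local; updateAt-id; updateAt-updates; updateAt-minimal)
open import Data.List using (List; []; _∷_; allFin; upTo; filter; cartesianProductWith)
import Data.List.Relation.Unary.All as All
open import Data.List.Relation.Unary.Any using (Any; here; there)
open import Data.List.Relation.Unary.Any.Properties using (cartesianProductWith⁺; applyUpTo⁺)
open import Data.List.Membership.Propositional using (_∈_; find)
open import Data.List.Membership.Propositional.Properties using (∈-allFin; ∈-filter⁺; ∈-filter⁻)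
open import Algebra.Bundles using (CommutativeMonoid)
import Algebra.Properties.AbelianGroup as AbelianGroupProperties
open import Algebra.Properties.CommutativeSemigroup +-commutativeSemigroup using () renaming (xy∙z≈xz∙y to m+n+o≡m+o+n)
import Algebra.Properties.CommutativeMonoid.Sum as Sum
import Algebra.Solver.CommutativeMonoid as CMSolver
open import Induction.WellFounded using (Acc; acc)
open import Relation.Binary.Bundles using (Poset; TotalOrder)
open import Relation.Binary.Structures using (IsTotalOrder)
import Relation.Binary.Reasoning.PartialOrder as PosetReasoning
open import Relation.Binary.PropositionalEquality
  using (_≡_; _≢_; refl; sym; trans; cong; cong₂; subst; subst₂; _≗_; module ≡-Reasoning)
open import Relation.Nullary using (Dec; yes; no; ¬_; contradiction)
open import Relation.Nullary.Decidable using (_×-dec_)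

module _ {c ℓ} (M : CommutativeMonoid c ℓ) where
  open CommutativeMonoid M using (Carrier; _≈_; _∙_; assoc; ∙-congˡ; setoid) renaming (refl to ≈-refl)
  open Sum M using (sum)
  open CMSolver M using (solve; _⊕_; _⊜_)
  open import Relation.Binary.Reasoning.Setoid setoid

  sum-updateAt : ∀ {a} {A : Set a} {n} (F : Fin n → A → Carrier) (v : Vector A n) j (φ : A → A) →
                 sum (λ l → F l (updateAt v j φ l)) ∙ F j (v j) ≈ sum (λ l → F l (v l)) ∙ F j (φ (v j))
  sum-updateAt F v zero φ =
    solve 3 (λ a s b → (b ⊕ s) ⊕ a ⊜ (a ⊕ s) ⊕ b) ≈-refl (F zero (v zero)) _ (F zero (φ (v zero)))
  sum-updateAt F v (suc j) φ = begin
    (F zero (v zero) ∙ S′) ∙ F (suc j) (v (suc j))     ≈⟨ assoc _ _ _ ⟩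
    F zero (v zero) ∙ (S′ ∙ F (suc j) (v (suc j)))     ≈⟨ ∙-congˡ (sum-updateAt (λ l → F (suc l)) (λ l → v (suc l)) j φ) ⟩
    F zero (v zero) ∙ (S ∙ F (suc j) (φ (v (suc j)))) ≈⟨ assoc _ _ _ ⟨
    (F zero (v zero) ∙ S) ∙ F (suc j) (φ (v (suc j)))  ∎
    where
    S′ = sum (λ l → F (suc l) (updateAt (λ l → v (suc l)) j φ l))
    S = sum (λ l → F (suc l) (v (suc l)))

sumℕ≡sum : ∀ {n} (g : Fin n → ℕ) → sumℕ g ≡ Sum.sum +-0-commutativeMonoid g
sumℕ≡sum {zero} g = refl
sumℕ≡sum {suc n} g = cong (g zero +_) (sumℕ≡sum (λ l → g (suc l)))

module _ {n : ℕ} where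

  sumℕ-cong : {g h : Fin n → ℕ} → g ≗ h → sumℕ g ≡ sumℕ h
  sumℕ-cong {g} {h} g≗h = trans (sumℕ≡sum g) (trans (Sum.sum-cong-≗ +-0-commutativeMonoid g≗h) (sym (sumℕ≡sum h)))

  sumℕ-+ : (g h : Fin n → ℕ) → sumℕ (λ l → g l + h l) ≡ sumℕ g + sumℕ h
  sumℕ-+ g h rewrite sumℕ≡sum (λ l → g l + h l) | sumℕ≡sum g | sumℕ≡sum h =
    Sum.∑-distrib-+ +-0-commutativeMonoid g h

  sumℕ-updateAt : ∀ (F : Fin n → ℕ → ℕ) (v : Fin n → ℕ) j (φ : ℕ → ℕ) →
                  sumℕ (λ l → F l (updateAt v j φ l)) + F j (v j) ≡ sumℕ (λ l → F l (v l)) + F j (φ (v j))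
  sumℕ-updateAt F v j φ rewrite sumℕ≡sum (λ l → F l (updateAt v j φ l)) | sumℕ≡sum (λ l → F l (v l)) =
    sum-updateAt +-0-commutativeMonoid F v j φ

sumℕ-mono : ∀ {n} {g h : Fin n → ℕ} → (∀ l → g l ≤ h l) → sumℕ g ≤ sumℕ h
sumℕ-mono {zero}  g≤h = z≤n
sumℕ-mono {suc n} g≤h = +-mono-≤ (g≤h zero) (sumℕ-mono (λ l → g≤h (suc l)))

sumℕ-mono-< : ∀ {n} {g h : Fin n → ℕ} → (∀ l → g l ≤ h l) → ∀ i → g i < h i → sumℕ g < sumℕ h
sumℕ-mono-< g≤h zero    gi<hi = +-mono-<-≤ gi<hi (sumℕ-mono (λ l → g≤h (suc l)))
sumℕ-mono-< g≤h (suc i) gi<hi = +-mono-≤-< (g≤h zero) (sumℕ-mono-< (λ l → g≤h (suc l)) i gi<hi)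

≤-sumℕ : ∀ {n} (g : Fin n → ℕ) i → g i ≤ sumℕ g
≤-sumℕ g zero    = m≤m+n _ _
≤-sumℕ g (suc i) = ≤-trans (≤-sumℕ (λ l → g (suc l)) i) (m≤n+m _ _)

-- Unit moves and the modular function x[ v ]

module _ {n : ℕ} where

  inc dec : Fin n → (Fin n → ℕ) → Fin n → ℕ
  inc i v = updateAt v i suc
  dec i v = updateAt v i pred

  move : Fin n → Fin n → (Fin n → ℕ) → Fin n → ℕ
  move i k v = inc k (dec i v)

  inc-dec : ∀ {v : Fin n → ℕ} i → 0 < v i → inc i (dec i v) ≗ v
  inc-dec {v} i 0<vi l =
    trans (updateAt-updateAt-local i v (suc-pred (v i) {{>-nonZero 0<vi}}) l) (updateAt-id i v l)

  lookup-∪ : ∀ (A B : Subset n) l → lookup (A ∪ B) l ≡ lookup A l ∨ lookup B l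
  lookup-∪ A B l = lookup-zipWith _∨_ l A B

  lookup-∩ : ∀ (A B : Subset n) l → lookup (A ∩ B) l ≡ lookup A l ∧ lookup B l
  lookup-∩ A B l = lookup-zipWith _∧_ l A B

  restrict : (Fin n → ℕ) → Subset n → Fin n → ℕ
  restrict v U l = if lookup U l then v l else 0

  indicator : Subset n → Fin n → ℕ
  indicator U j = if lookup U j then 1 else 0

  x[]-cong : ∀ {v w : Fin n → ℕ} U → v ≗ w → x[ v ] U ≡ x[ w ] U
  x[]-cong U v≗w = sumℕ-cong (λ l → cong (λ a → if lookup U l then a else 0) (v≗w l))

  x[]-inc : ∀ (v : Fin n → ℕ) U j → x[ inc j v ] U ≡ x[ v ] U + indicator U j
  x[]-inc v U j = +-cancelʳ-≡ (F j (v j)) _ _ (begin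
      x[ inc j v ] U + F j (v j)          ≡⟨ sumℕ-updateAt F v j suc ⟩
      x[ v ] U + F j (suc (v j))          ≡⟨ cong (x[ v ] U +_) (F-suc (lookup U j)) ⟩
      x[ v ] U + (indicator U j + F j (v j)) ≡⟨ +-assoc (x[ v ] U) _ _ ⟨
      x[ v ] U + indicator U j + F j (v j) ∎)
    where
    open ≡-Reasoning
    F : Fin n → ℕ → ℕ
    F l a = if lookup U l then a else 0
    F-suc : ∀ b {a} → (if b then suc a else 0) ≡ (if b then 1 else 0) + (if b then a else 0)
    F-suc true  = refl
    F-suc false = refl

  x[]-move : ∀ (v : Fin n → ℕ) U i k → 0 < v i → x[ move i k v ] U + indicator U i ≡ x[ v ] U + indicator U k
  x[]-move v U i k 0<vi = begin
    x[ move i k v ] U + indicator U i                   ≡⟨ cong (_+ indicator U i) (x[]-inc w U k) ⟩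
    x[ w ] U + indicator U k + indicator U i           ≡⟨ m+n+o≡m+o+n (x[ w ] U) _ _ ⟩
    x[ w ] U + indicator U i + indicator U k           ≡⟨ cong (_+ indicator U k) (x[]-inc w U i) ⟨
    x[ inc i w ] U + indicator U k                      ≡⟨ cong (_+ indicator U k) (x[]-cong U (inc-dec i 0<vi)) ⟩
    x[ v ] U + indicator U k                            ∎
    where
    open ≡-Reasoning
    w = dec i v

  x[]-⊤ : ∀ (v : Fin n → ℕ) → x[ v ] ⊤ ≡ sumℕ v
  x[]-⊤ v = sumℕ-cong (λ l → cong (λ b → if b then v l else 0) (lookup-replicate l true))

  indicator-⊤ : ∀ j → indicator ⊤ j ≡ 1
  indicator-⊤ j = cong (λ b → if b then 1 else 0) (lookup-replicate j true)

  sumℕ-move : ∀ (v : Fin n → ℕ) i k → 0 < v i → sumℕ (move i k v) ≡ sumℕ v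
  sumℕ-move v i k 0<vi = +-cancelʳ-≡ 1 _ _ (begin
    sumℕ (move i k v) + 1                ≡⟨ cong₂ _+_ (x[]-⊤ (move i k v)) (indicator-⊤ i) ⟨
    x[ move i k v ] ⊤ + indicator ⊤ i    ≡⟨ x[]-move v ⊤ i k 0<vi ⟩
    x[ v ] ⊤ + indicator ⊤ k             ≡⟨ cong₂ _+_ (x[]-⊤ v) (indicator-⊤ k) ⟩
    sumℕ v + 1                           ∎)
    where open ≡-Reasoning

  x[]-modular : ∀ (v : Fin n → ℕ) A B → x[ v ] (A ∪ B) + x[ v ] (A ∩ B) ≡ x[ v ] A + x[ v ] B
  x[]-modular v A B = begin
    x[ v ] (A ∪ B) + x[ v ] (A ∩ B)                           ≡⟨ sumℕ-+ (restrict v (A ∪ B)) (restrict v (A ∩ B)) ⟨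
    sumℕ (λ l → restrict v (A ∪ B) l + restrict v (A ∩ B) l)  ≡⟨ sumℕ-cong pointwise ⟩
    sumℕ (λ l → restrict v A l + restrict v B l)              ≡⟨ sumℕ-+ (restrict v A) (restrict v B) ⟩
    x[ v ] A + x[ v ] B                                       ∎
    where
    open ≡-Reasoning
    pointwise : ∀ l → restrict v (A ∪ B) l + restrict v (A ∩ B) l ≡ restrict v A l + restrict v B l
    pointwise l rewrite lookup-∪ A B l | lookup-∩ A B l with lookup A l | lookup B l
    ... | true  | true  = refl
    ... | true  | false = refl
    ... | false | true  = +-identityʳ (v l)
    ... | false | false = refl

-- Polymatroids and the simultaneous exchange property

InPolymatroid : ∀ {n} → (Subset n → ℕ) → (Fin n → ℕ) → Set
InPolymatroid f v = ∀ U → x[ v ] U ≤ f U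

Tight : ∀ {n} → (Subset n → ℕ) → (Fin n → ℕ) → Subset n → Set
Tight f v U = f U ≤ x[ v ] U

module _ {n} (f : Subset n → ℕ) where

  inPolymatroid-or-violated : ∀ v → InPolymatroid f v ⊎ ∃ λ U → f U < x[ v ] U
  inPolymatroid-or-violated v with anySubset? (λ U → f U <? x[ v ] U)
  ... | yes violated = inj₂ violated
  ... | no ¬violated = inj₁ (λ U → ≮⇒≥ (λ lt → ¬violated (U , lt)))

  inPolymatroid? : ∀ v → Dec (InPolymatroid f v)
  inPolymatroid? v with inPolymatroid-or-violated v
  ... | inj₁ v∈P        = yes v∈P
  ... | inj₂ (U , f<xU) = no (λ v∈P → <⇒≱ f<xU (v∈P U))

  move-violation : ∀ {v U} i k → InPolymatroid f v → 0 < v i → f U < x[ move i k v ] U →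
                   lookup U k ≡ true × lookup U i ≡ false × Tight f v U
  move-violation {v} {U} i k v∈P 0<vi f<x′ =
    cases (lookup U i) (lookup U k) (x[]-move v U i k 0<vi) (v∈P U) f<x′
    where
    cases : ∀ bi bk {X′ X F} → X′ + (if bi then 1 else 0) ≡ X + (if bk then 1 else 0) →
            X ≤ F → F < X′ → bk ≡ true × bi ≡ false × F ≤ X
    cases true  true  eq X≤F F<X′ = contradiction (≤-trans (≤-reflexive (+-cancelʳ-≡ 1 _ _ eq)) X≤F) (<⇒≱ F<X′)
    cases true  false {X′} eq X≤F F<X′ =
      contradiction (≤-trans (≤-trans (m≤m+n X′ 1) (≤-reflexive (trans eq (+-identityʳ _)))) X≤F) (<⇒≱ F<X′)
    cases false true  {X′} {X} eq X≤F F<X′ =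
      refl , refl , s≤s⁻¹ (≤-trans F<X′ (≤-reflexive (trans (sym (+-identityʳ X′)) (trans eq (+-comm X 1)))))
    cases false false {X′} {X} eq X≤F F<X′ =
      contradiction (≤-trans (≤-reflexive (trans (sym (+-identityʳ X′)) (trans eq (+-identityʳ X)))) X≤F) (<⇒≱ F<X′)

  record Exchange (x z : Fin n → ℕ) (i k : Fin n) : Set where
    field
      z<x     : z i < x i
      x<z     : x k < z k
      x-moved : InPolymatroid f (move i k x)
      z-moved : InPolymatroid f (move k i z)

  exchange-sym : ∀ {x z i k} → Exchange x z i k → Exchange z x k i
  exchange-sym e = record { z<x = x<z ; x<z = z<x ; x-moved = z-moved ; z-moved = x-moved }
    where open Exchange e

module _ {n} {f : Subset n → ℕ} (pm : IsPolymatroid f) where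
  open IsPolymatroid pm

  tight-∪ : ∀ {v A B} → InPolymatroid f v → Tight f v A → Tight f v B → Tight f v (A ∪ B)
  tight-∪ {v} {A} {B} v∈P A-tight B-tight = +-cancelʳ-≤ (f (A ∩ B)) _ _ (begin
    f (A ∪ B) + f (A ∩ B)             ≤⟨ submodular A B ⟩
    f A + f B                         ≤⟨ +-mono-≤ A-tight B-tight ⟩
    x[ v ] A + x[ v ] B               ≡⟨ x[]-modular v A B ⟨
    x[ v ] (A ∪ B) + x[ v ] (A ∩ B)   ≤⟨ +-monoʳ-≤ (x[ v ] (A ∪ B)) (v∈P (A ∩ B)) ⟩
    x[ v ] (A ∪ B) + f (A ∩ B)        ∎)
    where open ≤-Reasoning

  tight-∩ : ∀ {v A B} → InPolymatroid f v → Tight f v A → Tight f v B → Tight f v (A ∩ B)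
  tight-∩ {v} {A} {B} v∈P A-tight B-tight = +-cancelˡ-≤ (f (A ∪ B)) _ _ (begin
    f (A ∪ B) + f (A ∩ B)             ≤⟨ submodular A B ⟩
    f A + f B                         ≤⟨ +-mono-≤ A-tight B-tight ⟩
    x[ v ] A + x[ v ] B               ≡⟨ x[]-modular v A B ⟨
    x[ v ] (A ∪ B) + x[ v ] (A ∩ B)   ≤⟨ +-monoˡ-≤ (x[ v ] (A ∩ B)) (v∈P (A ∪ B)) ⟩
    f (A ∪ B) + x[ v ] (A ∩ B)        ∎)
    where open ≤-Reasoning

  tight-crossing : ∀ {x y S U} → InPolymatroid f x → InPolymatroid f y → sumℕ x ≤ sumℕ y →
             Tight f x S → Tight f y U ⊎ U ≡ ⊤ →
             x[ x ] (U ∪ S) + x[ y ] S ≤ x[ y ] (U ∪ S) + x[ x ] S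
  tight-crossing {x} {y} {S} x∈P y∈P Σx≤Σy S-tight (inj₂ refl) rewrite ∪-zeroˡ S | x[]-⊤ x | x[]-⊤ y =
    +-mono-≤ Σx≤Σy (≤-trans (y∈P S) S-tight)
  tight-crossing {x} {y} {S} {U} x∈P y∈P _ S-tight (inj₁ U-tight) = +-cancelʳ-≤ (x[ y ] (U ∩ S)) _ _ (begin
    x[ x ] (U ∪ S) + x[ y ] S + x[ y ] (U ∩ S)   ≡⟨ m+n+o≡m+o+n (x[ x ] (U ∪ S)) _ _ ⟩
    x[ x ] (U ∪ S) + x[ y ] (U ∩ S) + x[ y ] S   ≤⟨ +-monoˡ-≤ (x[ y ] S) (begin
      x[ x ] (U ∪ S) + x[ y ] (U ∩ S)              ≤⟨ +-mono-≤ (x∈P (U ∪ S)) (y∈P (U ∩ S)) ⟩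
      f (U ∪ S) + f (U ∩ S)                        ≤⟨ submodular U S ⟩
      f U + f S                                    ≤⟨ +-mono-≤ U-tight S-tight ⟩
      x[ y ] U + x[ x ] S                          ∎) ⟩
    x[ y ] U + x[ x ] S + x[ y ] S               ≡⟨ m+n+o≡m+o+n (x[ y ] U) _ _ ⟩
    x[ y ] U + x[ y ] S + x[ x ] S               ≡⟨ cong (_+ x[ x ] S) (x[]-modular y U S) ⟨
    x[ y ] (U ∪ S) + x[ y ] (U ∩ S) + x[ x ] S   ≡⟨ m+n+o≡m+o+n (x[ y ] (U ∪ S)) _ _ ⟩
    x[ y ] (U ∪ S) + x[ x ] S + x[ y ] (U ∩ S)   ∎)
    where open ≤-Reasoning

  Blocked : (x y : Fin n → ℕ) (i j : Fin n) → Set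
  Blocked x y i j = (∃ λ S → lookup S j ≡ true × lookup S i ≡ false × Tight f x S)
                  ⊎ (∃ λ U → lookup U i ≡ true × lookup U j ≡ false × Tight f y U)

  blocked : ∀ {x y} i j → InPolymatroid f x → InPolymatroid f y → y i < x i → x j < y j →
            ¬ (InPolymatroid f (move i j x) × InPolymatroid f (move j i y)) → Blocked x y i j
  blocked {x} {y} i j x∈P y∈P yi<xi xj<yj ¬both with inPolymatroid-or-violated f (move i j x)
  ... | inj₂ (S , violated) = inj₁ (S , move-violation f i j x∈P (≤-<-trans z≤n yi<xi) violated)
  ... | inj₁ x′∈P with inPolymatroid-or-violated f (move j i y)
  ...   | inj₂ (U , violated) = inj₂ (U , move-violation f j i y∈P (≤-<-trans z≤n xj<yj) violated)
  ...   | inj₁ y′∈P = contradiction (x′∈P , y′∈P) ¬both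

  record Separator (x y : Fin n → ℕ) (i : Fin n) (J : List (Fin n)) : Set where
    field
      S U       : Subset n
      i∉S       : lookup S i ≡ false
      i∈U       : lookup U i ≡ true
      S-tight   : Tight f x S
      U-tight   : Tight f y U ⊎ U ≡ ⊤
      separates : ∀ {j} → j ∈ J → x j < y j → lookup S j ≡ true ⊎ lookup U j ≡ false

  separator : ∀ {x y i} → InPolymatroid f x → InPolymatroid f y → ∀ J →
              (∀ {j} → j ∈ J → x j < y j → Blocked x y i j) → Separator x y i J
  separator {x} {y} {i} x∈P y∈P [] _ = record
    { S = ∅ ; U = ⊤ ; i∉S = lookup-replicate i false ; i∈U = lookup-replicate i true
    ; S-tight = ≤-trans (≤-reflexive normalized) z≤n ; U-tight = inj₂ refl ; separates = λ () }
  separator {x} {y} {i} x∈P y∈P (j ∷ J) block with separator x∈P y∈P J (block ∘ there) | x j <? y j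
  ... | sep | no xj≮yj = record { Separator sep ; separates = separates′ }
    where
    open Separator sep
    separates′ : ∀ {l} → l ∈ j ∷ J → x l < y l → _
    separates′ (here refl) xj<yj = contradiction xj<yj xj≮yj
    separates′ (there l∈J) xl<yl = separates l∈J xl<yl
  ... | sep | yes xj<yj with block (here refl) xj<yj
  ...   | inj₁ (S′ , j∈S′ , i∉S′ , S′-tight) = record
          { S = S ∪ S′ ; U = U ; i∉S = trans (lookup-∪ S S′ i) (cong₂ _∨_ i∉S i∉S′) ; i∈U = i∈U
          ; S-tight = tight-∪ x∈P S-tight S′-tight ; U-tight = U-tight ; separates = separates′ }
    where
    open Separator sep
    separates′ : ∀ {l} → l ∈ j ∷ J → x l < y l → _
    separates′ (here refl) _ = inj₁ (trans (lookup-∪ S S′ j) (trans (cong (lookup S j ∨_) j∈S′) (∨-zeroʳ _)))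
    separates′ {l} (there l∈J) xl<yl with separates l∈J xl<yl
    ... | inj₁ l∈S = inj₁ (trans (lookup-∪ S S′ l) (cong (_∨ lookup S′ l) l∈S))
    ... | inj₂ l∉U = inj₂ l∉U
  ...   | inj₂ (U′ , i∈U′ , j∉U′ , U′-tight) = record
          { S = S ; U = U ∩ U′ ; i∉S = i∉S ; i∈U = trans (lookup-∩ U U′ i) (cong₂ _∧_ i∈U i∈U′)
          ; S-tight = S-tight ; U-tight = inj₁ U∩U′-tight ; separates = separates′ }
    where
    open Separator sep
    U∩U′-tight : Tight f y (U ∩ U′)
    U∩U′-tight with U-tight
    ... | inj₁ U-tight′ = tight-∩ y∈P U-tight′ U′-tight
    ... | inj₂ refl     = subst (Tight f y) (sym (∩-identityˡ U′)) U′-tight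
    separates′ : ∀ {l} → l ∈ j ∷ J → x l < y l → _
    separates′ (here refl) _ = inj₂ (trans (lookup-∩ U U′ j) (trans (cong (lookup U j ∧_) j∉U′) (∧-zeroʳ _)))
    separates′ {l} (there l∈J) xl<yl with separates l∈J xl<yl
    ... | inj₁ l∈S = inj₁ l∈S
    ... | inj₂ l∉U = inj₂ (trans (lookup-∩ U U′ l) (cong (_∧ lookup U′ l) l∉U))

  -- Coordinatewise y(U ∪ S) + x(S) ≤ x(U ∪ S) + y(S), strictly at i, contradicting tight-crossing.
  no-separator : ∀ {x y i} → InPolymatroid f x → InPolymatroid f y → sumℕ x ≤ sumℕ y → y i < x i →
                         ¬ Separator x y i (allFin n)
  no-separator {x} {y} {i} x∈P y∈P Σx≤Σy yi<xi sep =
    <⇒≱ (begin-strict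
      x[ y ] (U ∪ S) + x[ x ] S                       ≡⟨ sumℕ-+ (restrict y (U ∪ S)) (restrict x S) ⟨
      sumℕ (λ l → restrict y (U ∪ S) l + restrict x S l)  <⟨ sumℕ-mono-< dominated i strictly-at-i ⟩
      sumℕ (λ l → restrict x (U ∪ S) l + restrict y S l)  ≡⟨ sumℕ-+ (restrict x (U ∪ S)) (restrict y S) ⟩
      x[ x ] (U ∪ S) + x[ y ] S                       ∎)
      (tight-crossing x∈P y∈P Σx≤Σy S-tight U-tight)
    where
    open Separator sep
    open ≤-Reasoning
    dominated : ∀ l → restrict y (U ∪ S) l + restrict x S l ≤ restrict x (U ∪ S) l + restrict y S l
    dominated l rewrite lookup-∪ U S l with lookup U l in l∈?U | lookup S l in l∈?S
    ... | true  | true  = ≤-reflexive (+-comm (y l) (x l))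
    ... | false | true  = ≤-reflexive (+-comm (y l) (x l))
    ... | false | false = ≤-refl
    ... | true  | false = +-monoˡ-≤ 0 (≮⇒≥ λ xl<yl → unseparated (separates (∈-allFin l) xl<yl))
      where
      unseparated : ¬ (lookup S l ≡ true ⊎ lookup U l ≡ false)
      unseparated (inj₁ l∈S) with trans (sym l∈?S) l∈S
      ... | ()
      unseparated (inj₂ l∉U) with trans (sym l∈?U) l∉U
      ... | ()
    strictly-at-i : restrict y (U ∪ S) i + restrict x S i < restrict x (U ∪ S) i + restrict y S i
    strictly-at-i rewrite lookup-∪ U S i | i∈U | i∉S = +-monoˡ-< 0 yi<xi

  exchange : ∀ {x y i} → InPolymatroid f x → InPolymatroid f y → sumℕ x ≤ sumℕ y → y i < x i →
             ∃ λ k → Exchange f x y i k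
  exchange {x} {y} {i} x∈P y∈P Σx≤Σy yi<xi
    with any? (λ k → x k <? y k ×-dec (inPolymatroid? f (move i k x) ×-dec inPolymatroid? f (move k i y)))
  ... | yes (k , xk<yk , x′∈P , y′∈P) =
    k , record { z<x = yi<xi ; x<z = xk<yk ; x-moved = x′∈P ; z-moved = y′∈P }
  ... | no none = ⊥-elim (no-separator x∈P y∈P Σx≤Σy yi<xi
                    (separator x∈P y∈P (allFin n) λ {j} _ xj<yj →
                      blocked i j x∈P y∈P yi<xi xj<yj (λ (x′∈P , y′∈P) → none (j , xj<yj , x′∈P , y′∈P))))

  exchange-or-bounded : ∀ {x z} (δ : Fin n → ℕ) → InPolymatroid f x → InPolymatroid f z → sumℕ x ≤ sumℕ z →
                        (∀ l → x l ∸ z l ≤ δ l) ⊎ ∃₂ λ i k → Exchange f x z i k × z i + δ i < x i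
  exchange-or-bounded {x} {z} δ x∈P z∈P Σx≤Σz with any? (λ i → z i + δ i <? x i)
  ... | no none = inj₁ (λ l → m≤n+o⇒m∸n≤o (x l) (z l) (≮⇒≥ (λ lt → none (l , lt))))
  ... | yes (i , zi+δi<xi) with exchange x∈P z∈P Σx≤Σz (≤-<-trans (m≤m+n (z i) (δ i)) zi+δi<xi)
  ...   | k , ex = inj₂ (i , k , ex , zi+δi<xi)

∣m-n∣≡1+∣m-1+n∣ : ∀ {m n} → n < m → ∣ m - n ∣ ≡ suc ∣ m - suc n ∣
∣m-n∣≡1+∣m-1+n∣ {suc m} {zero}  _          = cong suc (sym (∣-∣-identityʳ m))
∣m-n∣≡1+∣m-1+n∣ {suc m} {suc n} (s≤s n<m) = ∣m-n∣≡1+∣m-1+n∣ n<m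

∣m-1+n∣≡1+∣m-n∣ : ∀ {m n} → m ≤ n → ∣ m - suc n ∣ ≡ suc ∣ m - n ∣
∣m-1+n∣≡1+∣m-n∣ {m} {n} m≤n =
  trans (∣-∣-comm m (suc n)) (trans (∣m-n∣≡1+∣m-1+n∣ (s≤s m≤n)) (cong suc (∣-∣-comm n m)))

∣m-n∣≡[m∸n]+[n∸m] : ∀ m n → ∣ m - n ∣ ≡ (m ∸ n) + (n ∸ m)
∣m-n∣≡[m∸n]+[n∸m] zero    zero    = refl
∣m-n∣≡[m∸n]+[n∸m] zero    (suc n) = refl
∣m-n∣≡[m∸n]+[n∸m] (suc m) zero    = sym (+-identityʳ (suc m))
∣m-n∣≡[m∸n]+[n∸m] (suc m) (suc n) = ∣m-n∣≡[m∸n]+[n∸m] m n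

m+[n∸m]≡n+[m∸n] : ∀ m n → m + (n ∸ m) ≡ n + (m ∸ n)
m+[n∸m]≡n+[m∸n] zero    zero    = refl
m+[n∸m]≡n+[m∸n] zero    (suc n) = sym (+-identityʳ (suc n))
m+[n∸m]≡n+[m∸n] (suc m) zero    = +-identityʳ (suc m)
m+[n∸m]≡n+[m∸n] (suc m) (suc n) = cong suc (m+[n∸m]≡n+[m∸n] m n)

n∸m≤∣m-n∣ : ∀ m n → n ∸ m ≤ ∣ m - n ∣
n∸m≤∣m-n∣ m n = ≤-trans (m∸n≤∣m-n∣ n m) (≤-reflexive (∣-∣-comm n m))

m≤n⇒o+[m∸n]≡o : ∀ {m n} o → m ≤ n → o + (m ∸ n) ≡ o
m≤n⇒o+[m∸n]≡o o m≤n = trans (cong (o +_) (m≤n⇒m∸n≡0 m≤n)) (+-identityʳ o)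

∣m-m⊓n∣+∣m⊓n-n∣≡∣m-n∣ : ∀ m n → ∣ m - m ⊓ n ∣ + ∣ m ⊓ n - n ∣ ≡ ∣ m - n ∣
∣m-m⊓n∣+∣m⊓n-n∣≡∣m-n∣ m n with ≤-total m n
... | inj₁ m≤n rewrite m≤n⇒m⊓n≡m m≤n | ∣n-n∣≡0 m = refl
... | inj₂ n≤m rewrite m≥n⇒m⊓n≡n n≤m | ∣n-n∣≡0 n = +-identityʳ _

module _ {n : ℕ} where

  dist₁-cong : ∀ (x : Fin n → ℕ) {v w} → v ≗ w → dist₁ x v ≡ dist₁ x w
  dist₁-cong x v≗w = sumℕ-cong (λ l → cong (∣ x l -_∣) (v≗w l))

  dist₁-comm : ∀ (x y : Fin n → ℕ) → dist₁ x y ≡ dist₁ y x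
  dist₁-comm x y = sumℕ-cong (λ l → ∣-∣-comm (x l) (y l))

  dist₁-triangle : ∀ (x y z : Fin n → ℕ) → dist₁ x z ≤ dist₁ x y + dist₁ y z
  dist₁-triangle x y z = ≤-trans (sumℕ-mono (λ l → ∣-∣-triangle (x l) (y l) (z l)))
                                 (≤-reflexive (sumℕ-+ (λ l → ∣ x l - y l ∣) (λ l → ∣ y l - z l ∣)))

  dist₁-⊓ : ∀ (x y : Fin n → ℕ) → dist₁ x (λ l → x l ⊓ y l) + dist₁ (λ l → x l ⊓ y l) y ≡ dist₁ x y
  dist₁-⊓ x y = trans (sym (sumℕ-+ (λ l → ∣ x l - x l ⊓ y l ∣) (λ l → ∣ x l ⊓ y l - y l ∣))) (sumℕ-cong (λ l → ∣m-m⊓n∣+∣m⊓n-n∣≡∣m-n∣ (x l) (y l)))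

  dist₁-inc : ∀ (x v : Fin n → ℕ) j → dist₁ x (inc j v) + ∣ x j - v j ∣ ≡ dist₁ x v + ∣ x j - suc (v j) ∣
  dist₁-inc x v j = sumℕ-updateAt (λ l a → ∣ x l - a ∣) v j suc

  dist₁-move : ∀ {x z : Fin n → ℕ} {i k} → z i < x i → x k < z k → dist₁ x (move k i z) + 2 ≡ dist₁ x z
  dist₁-move {x} {z} {i} {k} zi<xi xk<zk = begin
    dist₁ x (move k i z) + 2         ≡⟨ +-assoc (dist₁ x (inc i w)) 1 1 ⟨
    dist₁ x (inc i w) + 1 + 1        ≡⟨ cong (_+ 1) raise-i ⟩
    dist₁ x w + 1                    ≡⟨ lower-k ⟨
    dist₁ x z                        ∎
    where
    open ≡-Reasoning
    w = dec k z
    i≢k : i ≢ k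
    i≢k refl = <-asym zi<xi xk<zk
    wi≡zi : w i ≡ z i
    wi≡zi = updateAt-minimal i k z i≢k
    xk≤wk : x k ≤ w k
    xk≤wk = ≤-trans (<⇒≤pred xk<zk) (≤-reflexive (sym (updateAt-updates k z)))
    raise-i : dist₁ x (inc i w) + 1 ≡ dist₁ x w
    raise-i = +-cancelʳ-≡ ∣ x i - suc (w i) ∣ _ _ (begin
      dist₁ x (inc i w) + 1 + ∣ x i - suc (w i) ∣    ≡⟨ +-assoc (dist₁ x (inc i w)) 1 _ ⟩
      dist₁ x (inc i w) + suc ∣ x i - suc (w i) ∣    ≡⟨ cong (dist₁ x (inc i w) +_) (∣m-n∣≡1+∣m-1+n∣ (subst (_< x i) (sym wi≡zi) zi<xi)) ⟨
      dist₁ x (inc i w) + ∣ x i - w i ∣              ≡⟨ dist₁-inc x w i ⟩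
      dist₁ x w + ∣ x i - suc (w i) ∣                ∎)
    lower-k : dist₁ x z ≡ dist₁ x w + 1
    lower-k = +-cancelʳ-≡ ∣ x k - w k ∣ _ _ (begin
      dist₁ x z + ∣ x k - w k ∣                      ≡⟨ cong (_+ ∣ x k - w k ∣) (dist₁-cong x (inc-dec k (≤-<-trans z≤n xk<zk))) ⟨
      dist₁ x (inc k w) + ∣ x k - w k ∣              ≡⟨ dist₁-inc x w k ⟩
      dist₁ x w + ∣ x k - suc (w k) ∣                ≡⟨ cong (dist₁ x w +_) (∣m-1+n∣≡1+∣m-n∣ xk≤wk) ⟩
      dist₁ x w + suc ∣ x k - w k ∣                  ≡⟨ +-assoc (dist₁ x w) 1 _ ⟨
      dist₁ x w + 1 + ∣ x k - w k ∣                  ∎)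

  -- Since Σ z = Σ x + c, the positive parts of z − x add up to those of x − z plus c.
  dist₁-≤ : ∀ {x z : Fin n → ℕ} {c} (δ : Fin n → ℕ) → sumℕ z ≡ sumℕ x + c → (∀ l → x l ∸ z l ≤ δ l) →
            dist₁ x z ≤ 2 * sumℕ δ + c
  dist₁-≤ {x} {z} {c} δ Σz≡Σx+c x∸z≤δ = begin
    dist₁ x z                     ≡⟨ sumℕ-cong (λ l → ∣m-n∣≡[m∸n]+[n∸m] (x l) (z l)) ⟩
    sumℕ (λ l → (x l ∸ z l) + (z l ∸ x l)) ≡⟨ sumℕ-+ (λ l → x l ∸ z l) (λ l → z l ∸ x l) ⟩
    excess + deficit              ≡⟨ cong (excess +_) deficit≡ ⟩
    excess + (excess + c)         ≡⟨ +-assoc excess excess c ⟨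
    excess + excess + c           ≤⟨ +-monoˡ-≤ c (+-mono-≤ excess≤ excess≤) ⟩
    sumℕ δ + sumℕ δ + c           ≡⟨ cong (λ a → sumℕ δ + a + c) (+-identityʳ (sumℕ δ)) ⟨
    2 * sumℕ δ + c                ∎
    where
    open ≤-Reasoning
    excess = sumℕ (λ l → x l ∸ z l)
    deficit = sumℕ (λ l → z l ∸ x l)
    excess≤ : excess ≤ sumℕ δ
    excess≤ = sumℕ-mono x∸z≤δ
    deficit≡ : deficit ≡ excess + c
    deficit≡ = +-cancelˡ-≡ (sumℕ x) _ _ (begin-equality
      sumℕ x + deficit                       ≡⟨ sumℕ-+ x (λ l → z l ∸ x l) ⟨
      sumℕ (λ l → x l + (z l ∸ x l))         ≡⟨ sumℕ-cong (λ l → m+[n∸m]≡n+[m∸n] (x l) (z l)) ⟩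
      sumℕ (λ l → z l + (x l ∸ z l))         ≡⟨ sumℕ-+ z (λ l → x l ∸ z l) ⟩
      sumℕ z + excess                        ≡⟨ cong (_+ excess) Σz≡Σx+c ⟩
      sumℕ x + c + excess                    ≡⟨ m+n+o≡m+o+n (sumℕ x) c excess ⟩
      sumℕ x + excess + c                    ≡⟨ +-assoc (sumℕ x) excess c ⟩
      sumℕ x + (excess + c)                  ∎)

vectors : ∀ n → ℕ → List (Fin n → ℕ)
vectors zero    d = (λ ()) ∷ []
vectors (suc n) d = cartesianProductWith Vector._∷_ (upTo (suc d)) (vectors n d)

vectors-complete : ∀ n d (v : Fin n → ℕ) → (∀ i → v i ≤ d) → Any (_≗ v) (vectors n d)
vectors-complete zero    d v _   = here (λ ())
vectors-complete (suc n) d v v≤d =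
  cartesianProductWith⁺ Vector._∷_ cons-≗ (applyUpTo⁺ id refl (s≤s (v≤d zero)))
    (vectors-complete n d (λ l → v (suc l)) (λ l → v≤d (suc l)))
  where
  cons-≗ : ∀ {a w} → a ≡ v zero → w ≗ (λ l → v (suc l)) → (a Vector.∷ w) ≗ v
  cons-≗ a≡v0 w≗v′ zero    = a≡v0
  cons-≗ a≡v0 w≗v′ (suc l) = w≗v′ l

module _ {n} (f : Subset n → ℕ) where

  inBase-cong : ∀ {d v w} → v ≗ w → InBase f d w → InBase f d v
  inBase-cong {d} {v} {w} v≗w (w∈P , w⊤≡d) =
    (λ U → subst (_≤ f U) (sym (x[]-cong U v≗w)) (w∈P U)) , trans (x[]-cong ⊤ v≗w) w⊤≡d

  inBase? : ∀ d v → Dec (InBase f d v)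
  inBase? d v = inPolymatroid? f v ×-dec (x[ v ] ⊤ ≟ d)

  inBase-bounded : ∀ {d v} → InBase f d v → ∀ i → v i ≤ d
  inBase-bounded {d} {v} (_ , v⊤≡d) i = ≤-trans (≤-sumℕ v i) (≤-reflexive (trans (sym (x[]-⊤ v)) v⊤≡d))

  inBase-sumℕ : ∀ {d v} → InBase f d v → sumℕ v ≡ d
  inBase-sumℕ {v = v} (_ , v⊤≡d) = trans (sym (x[]-⊤ v)) v⊤≡d

  inBase-sumℕ-∸ : ∀ {d d′ v w} → InBase f d v → InBase f d′ w → d ≤ d′ → sumℕ w ≡ sumℕ v + (d′ ∸ d)
  inBase-sumℕ-∸ {d} {d′} v∈B w∈B d≤d′ =
    trans (inBase-sumℕ w∈B) (trans (sym (m+[n∸m]≡n d≤d′)) (cong (_+ (d′ ∸ d)) (sym (inBase-sumℕ v∈B))))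

-- Ordered groups, regular costs and optimal solutions

module _ (G : OrderedAbelianGroup) where
  open OrderedAbelianGroup G renaming (refl to ≈-refl; sym to ≈-sym; trans to ≈-trans; reflexive to ≈-reflexive)
  open AbelianGroupProperties abGroup using (xyx⁻¹≈y; ∙-cancelʳ)
  open import Algebra.Properties.CommutativeSemigroup commutativeSemigroup using (xy∙z≈xz∙y)

  poset : Poset 0ℓ 0ℓ 0ℓ
  poset = record { isPartialOrder = IsTotalOrder.isPartialOrder isTotalOrder }

  totalOrder : TotalOrder 0ℓ 0ℓ 0ℓ
  totalOrder = record { isTotalOrder = isTotalOrder }

  open Poset poset using () renaming (refl to ≤ᵍ-refl; trans to ≤ᵍ-trans; reflexive to ≤ᵍ-reflexive)

  ∙-monoʳ-≤ᵍ : ∀ x {y z} → y ≤ᵍ z → (x ∙ y) ≤ᵍ (x ∙ z)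
  ∙-monoʳ-≤ᵍ x {y} {z} y≤z = begin
    x ∙ y  ≈⟨ comm x y ⟩
    y ∙ x  ≤⟨ ∙-mono x y≤z ⟩
    z ∙ x  ≈⟨ comm z x ⟩
    x ∙ z  ∎
    where open PosetReasoning poset

  ∙-cancelʳ-≤ᵍ : ∀ z {x y} → (x ∙ z) ≤ᵍ (y ∙ z) → x ≤ᵍ y
  ∙-cancelʳ-≤ᵍ z {x} {y} le = begin
    x                ≈⟨ cancel x ⟨
    x ∙ z ∙ z ⁻¹     ≤⟨ ∙-mono (z ⁻¹) le ⟩
    y ∙ z ∙ z ⁻¹     ≈⟨ cancel y ⟩
    y                ∎
    where
    open PosetReasoning poset
    cancel : ∀ u → u ∙ z ∙ z ⁻¹ ≈ u
    cancel u = ≈-trans (assoc u z (z ⁻¹)) (≈-trans (∙-congˡ (inverseʳ z)) (identityʳ u))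

  ∙-cancelˡ-≤ᵍ : ∀ z {x y} → (z ∙ x) ≤ᵍ (z ∙ y) → x ≤ᵍ y
  ∙-cancelˡ-≤ᵍ z {x} {y} le = ∙-cancelʳ-≤ᵍ z (begin
    x ∙ z  ≈⟨ comm x z ⟩
    z ∙ x  ≤⟨ le ⟩
    z ∙ y  ≈⟨ comm z y ⟩
    y ∙ z  ∎)
    where open PosetReasoning poset

  ≤ᵍ-mono-ℕ : ∀ (g : ℕ → Carrier) → (∀ m → g m ≤ᵍ g (suc m)) → ∀ {m n} → m ≤ n → g m ≤ᵍ g n
  ≤ᵍ-mono-ℕ g step m≤n = mono′ (≤⇒≤′ m≤n)
    where
    mono′ : ∀ {m n} → m ≤′ n → g m ≤ᵍ g n
    mono′ ≤′-refl        = ≤ᵍ-refl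
    mono′ (≤′-step m≤′n) = ≤ᵍ-trans (mono′ m≤′n) (step _)

  C-suc≈C∙ΔC : ∀ (C : ℕ → ℕ → Carrier) a s → C (suc a) s ≈ C a s ∙ ΔC G C a s
  C-suc≈C∙ΔC C a s = ≈-sym (≈-trans (≈-sym (assoc (C a s) (C (suc a) s) (C a s ⁻¹))) (xyx⁻¹≈y (C a s) (C (suc a) s)))

  module _ {C : ℕ → ℕ → Carrier} (regular : Regular G C) where

    ΔC-monoˡ : ∀ {a b} s → a ≤ b → ΔC G C a s ≤ᵍ ΔC G C b s
    ΔC-monoˡ s = ≤ᵍ-mono-ℕ (λ a → ΔC G C a s) (λ a → ≤ᵍ-trans (proj₁ regular a s) (proj₂ regular a s))

    ΔC-monoʳ : ∀ a {s s′} → s ≤ s′ → ΔC G C a s ≤ᵍ ΔC G C a s′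
    ΔC-monoʳ a = ≤ᵍ-mono-ℕ (ΔC G C a) (proj₁ regular a)

    ΔC-shift : ∀ a s j → ΔC G C a (s + j) ≤ᵍ ΔC G C (a + j) s
    ΔC-shift a s zero = ≤ᵍ-reflexive (≈-reflexive (cong₂ (ΔC G C) (sym (+-identityʳ a)) (+-identityʳ s)))
    ΔC-shift a s (suc j) = begin
      ΔC G C a (s + suc j)      ≡⟨ cong (ΔC G C a) (+-suc s j) ⟩
      ΔC G C a (suc (s + j))    ≤⟨ proj₂ regular a (s + j) ⟩
      ΔC G C (suc a) (s + j)    ≤⟨ ΔC-shift (suc a) s j ⟩
      ΔC G C (suc a + j) s      ≡⟨ cong (λ b → ΔC G C b s) (+-suc a j) ⟨
      ΔC G C (a + suc j) s      ∎
      where open PosetReasoning poset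

    ΔC-transport : ∀ {a b s s′} → a + (s′ ∸ s) ≤ b → ΔC G C a s′ ≤ᵍ ΔC G C b s
    ΔC-transport {a} {b} {s} {s′} le with ≤-total s′ s
    ... | inj₁ s′≤s = ≤ᵍ-trans (ΔC-monoʳ a s′≤s) (ΔC-monoˡ s (subst (_≤ b) (m≤n⇒o+[m∸n]≡o a s′≤s) le))
    ... | inj₂ s≤s′ = begin
      ΔC G C a s′                ≡⟨ cong (ΔC G C a) (m+[n∸m]≡n s≤s′) ⟨
      ΔC G C a (s + (s′ ∸ s))    ≤⟨ ΔC-shift a s (s′ ∸ s) ⟩
      ΔC G C (a + (s′ ∸ s)) s    ≤⟨ ΔC-monoˡ s le ⟩
      ΔC G C b s                 ∎
      where open PosetReasoning poset

  sumG≡sum : ∀ {n} (g : Fin n → Carrier) → sumG G g ≡ Sum.sum commutativeMonoid g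
  sumG≡sum {zero}  g = refl
  sumG≡sum {suc n} g = cong (g zero ∙_) (sumG≡sum (λ l → g (suc l)))

  marginal : ∀ {n} → (Fin n → ℕ → ℕ → Carrier) → (Fin n → ℕ) → Fin n → ℕ → Carrier
  marginal C t j a = ΔC G (C j) a (t j)

  module _ {n} (C : Fin n → ℕ → ℕ → Carrier) (t : Fin n → ℕ) where

    cost-cong : ∀ {v w} → v ≗ w → cost G C t v ≡ cost G C t w
    cost-cong {v} {w} v≗w = begin
      cost G C t v                                          ≡⟨ sumG≡sum (λ l → C l (v l) (t l)) ⟩
      Sum.sum commutativeMonoid (λ l → C l (v l) (t l))     ≡⟨ Sum.sum-cong-≗ commutativeMonoid (λ l → cong (λ a → C l a (t l)) (v≗w l)) ⟩
      Sum.sum commutativeMonoid (λ l → C l (w l) (t l))     ≡⟨ sumG≡sum (λ l → C l (w l) (t l)) ⟨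
      cost G C t w                                          ∎
      where open ≡-Reasoning

    cost-inc : ∀ v j → cost G C t (inc j v) ≈ cost G C t v ∙ marginal C t j (v j)
    cost-inc v j = ∙-cancelʳ (C j (v j) (t j)) _ _ (begin
      cost G C t (inc j v) ∙ C j (v j) (t j)                ≡⟨ cong (_∙ C j (v j) (t j)) (sumG≡sum (λ l → F l (inc j v l))) ⟩
      Sum.sum commutativeMonoid (λ l → F l (inc j v l)) ∙ F j (v j) ≈⟨ sum-updateAt commutativeMonoid F v j suc ⟩
      Sum.sum commutativeMonoid (λ l → F l (v l)) ∙ F j (suc (v j)) ≡⟨ cong (_∙ F j (suc (v j))) (sumG≡sum (λ l → F l (v l))) ⟨
      cost G C t v ∙ C j (suc (v j)) (t j)                  ≈⟨ ∙-congˡ (C-suc≈C∙ΔC (C j) (v j) (t j)) ⟩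
      cost G C t v ∙ (C j (v j) (t j) ∙ marginal C t j (v j)) ≈⟨ assoc _ _ _ ⟨
      cost G C t v ∙ C j (v j) (t j) ∙ marginal C t j (v j) ≈⟨ xy∙z≈xz∙y _ _ _ ⟩
      cost G C t v ∙ marginal C t j (v j) ∙ C j (v j) (t j) ∎)
      where
      open import Relation.Binary.Reasoning.Setoid setoid
      F : Fin n → ℕ → Carrier
      F l a = C l a (t l)

    cost-move : ∀ v i k → 0 < v i → i ≢ k →
                cost G C t (move i k v) ∙ marginal C t i (pred (v i)) ≈ cost G C t v ∙ marginal C t k (v k)
    cost-move v i k 0<vi i≢k = begin
      cost G C t (inc k w) ∙ marginal C t i (pred (v i))   ≈⟨ ∙-congʳ (cost-inc w k) ⟩
      cost G C t w ∙ marginal C t k (w k) ∙ marginal C t i (pred (v i)) ≈⟨ xy∙z≈xz∙y _ _ _ ⟩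
      cost G C t w ∙ marginal C t i (pred (v i)) ∙ marginal C t k (w k) ≡⟨ cong₂ (λ a b → cost G C t w ∙ marginal C t i a ∙ marginal C t k b)
                                                                               (sym (updateAt-updates i v)) (updateAt-minimal k i v (i≢k ∘ sym)) ⟩
      cost G C t w ∙ marginal C t i (w i) ∙ marginal C t k (v k) ≈⟨ ∙-congʳ (cost-inc w i) ⟨
      cost G C t (inc i w) ∙ marginal C t k (v k)          ≡⟨ cong (_∙ marginal C t k (v k)) (cost-cong (inc-dec i 0<vi)) ⟩
      cost G C t v ∙ marginal C t k (v k)                  ∎
      where
      open import Relation.Binary.Reasoning.Setoid setoid
      w = dec i v

    marginal-≤⇒cost-≤ : ∀ {v} i k → 0 < v i → i ≢ k → marginal C t k (v k) ≤ᵍ marginal C t i (pred (v i)) →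
                  cost G C t (move i k v) ≤ᵍ cost G C t v
    marginal-≤⇒cost-≤ {v} i k 0<vi i≢k Δk≤Δi = ∙-cancelʳ-≤ᵍ (marginal C t i (pred (v i))) (begin
      cost G C t (move i k v) ∙ marginal C t i (pred (v i))  ≈⟨ cost-move v i k 0<vi i≢k ⟩
      cost G C t v ∙ marginal C t k (v k)                    ≤⟨ ∙-monoʳ-≤ᵍ (cost G C t v) Δk≤Δi ⟩
      cost G C t v ∙ marginal C t i (pred (v i))             ∎)
      where open PosetReasoning poset

    cost-≤⇒marginal-≤ : ∀ {v} i k → 0 < v i → i ≢ k → cost G C t v ≤ᵍ cost G C t (move i k v) →
                           marginal C t i (pred (v i)) ≤ᵍ marginal C t k (v k)
    cost-≤⇒marginal-≤ {v} i k 0<vi i≢k v≤v′ = ∙-cancelˡ-≤ᵍ (cost G C t v) (begin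
      cost G C t v ∙ marginal C t i (pred (v i))             ≤⟨ ∙-mono (marginal C t i (pred (v i))) v≤v′ ⟩
      cost G C t (move i k v) ∙ marginal C t i (pred (v i))  ≈⟨ cost-move v i k 0<vi i≢k ⟩
      cost G C t v ∙ marginal C t k (v k)                    ∎)
      where open PosetReasoning poset

  -- Base vectors have entries at most d, so a cheapest one is found among finitely many candidates.
  optimal-exists : ∀ {n} (f : Subset n → ℕ) (C : Fin n → ℕ → ℕ → Carrier) t d →
                   (∃ λ b → InBase f d b) → ∃ λ x → Optimal G f C t d x
  optimal-exists {n} f C t d (b , b∈B) = x , x∈B , x-minimal
    where
    open import Data.List.Extrema totalOrder using (argmin; argmin-sel; f[argmin]≤f[xs])
    candidates = filter (inBase? f d) (vectors n d)
    x = argmin (cost G C t) b candidates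
    x∈B : InBase f d x
    x∈B with argmin-sel (cost G C t) b candidates
    ... | inj₁ x≡b         = subst (InBase f d) (sym x≡b) b∈B
    ... | inj₂ x∈candidates = proj₂ (∈-filter⁻ (inBase? f d) {xs = vectors n d} x∈candidates)
    x-minimal : ∀ y → InBase f d y → cost G C t x ≤ᵍ cost G C t y
    x-minimal y y∈B with find (vectors-complete n d y (inBase-bounded f y∈B))
    ... | u , u∈vectors , u≗y = ≤ᵍ-trans
            (All.lookup (f[argmin]≤f[xs] b candidates) (∈-filter⁺ (inBase? f d) u∈vectors (inBase-cong f u≗y y∈B)))
            (≤ᵍ-reflexive (≈-reflexive (cost-cong C t u≗y)))

-- Proximity

module _ (G : OrderedAbelianGroup) {n} {f : Subset n → ℕ} (pm : IsPolymatroid f)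
         (C : Fin n → ℕ → ℕ → OrderedAbelianGroup.Carrier G) (regular : ∀ e → Regular G (C e)) where
  open OrderedAbelianGroup G using (_≤ᵍ_)
  open Poset (poset G) using () renaming (trans to ≤ᵍ-trans)

  -- The step z ↦ z − eₖ + eᵢ towards x; marginal-≤ makes it cost-non-increasing.
  record ImprovingMove (t x z : Fin n → ℕ) : Set where
    field
      i k        : Fin n
      z<x        : z i < x i
      x<z        : x k < z k
      z-moved    : InPolymatroid f (move k i z)
      marginal-≤ : marginal G C t i (z i) ≤ᵍ marginal G C t k (pred (z k))

  closer-optimum : ∀ {t d x z} → ImprovingMove t x z → Optimal G f C t d z →
            ∃ λ z′ → Optimal G f C t d z′ × dist₁ x z′ < dist₁ x z
  closer-optimum {t} {d} {x} {z} improving (z∈B , z-minimal) = move k i z , (z′∈B , z′-minimal) , closer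
    where
    open ImprovingMove improving
    0<zk : 0 < z k
    0<zk = ≤-<-trans z≤n x<z
    k≢i : k ≢ i
    k≢i refl = <-asym z<x x<z
    z′∈B : InBase f d (move k i z)
    z′∈B = z-moved , trans (x[]-⊤ (move k i z)) (trans (sumℕ-move z k i 0<zk) (inBase-sumℕ f z∈B))
    z′-minimal : ∀ y → InBase f d y → cost G C t (move k i z) ≤ᵍ cost G C t y
    z′-minimal y y∈B = ≤ᵍ-trans (marginal-≤⇒cost-≤ G C t k i 0<zk k≢i marginal-≤) (z-minimal y y∈B)
    closer : dist₁ x (move k i z) < dist₁ x z
    closer = <-≤-trans (m<m+n (dist₁ x (move k i z)) z<s) (≤-reflexive (dist₁-move {x = x} {z} z<x x<z))

  descent : ∀ {t d x bound} → (∀ z → InBase f d z → dist₁ x z ≤ bound ⊎ ImprovingMove t x z) →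
            ∀ {z} → Optimal G f C t d z → ∃ λ y → Optimal G f C t d y × dist₁ x y ≤ bound
  descent {t} {d} {x} {bound} step {z} z-opt = go z-opt (<-wellFounded (dist₁ x z))
    where
    go : ∀ {z} → Optimal G f C t d z → Acc _<_ (dist₁ x z) → ∃ λ y → Optimal G f C t d y × dist₁ x y ≤ bound
    go {z} z-opt (acc closer-accessible) with step z (proj₁ z-opt)
    ... | inj₁ close = z , z-opt , close
    ... | inj₂ improving with closer-optimum improving z-opt
    ...   | z′ , z′-opt , closer = go z′-opt (closer-accessible closer)

  -- Optimality of x links the two marginals at time t; regularity transports them to time t′.
  improving-move : ∀ {t t′ d x z i k} → Optimal G f C t d x → Exchange f x z i k →
                   z i + (t′ i ∸ t i) < x i → x k + (t k ∸ t′ k) < z k → ImprovingMove t′ x z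
  improving-move {t} {t′} {d} {x} {z} {i} {k} (x∈B , x-minimal) ex zi<xi xk<zk = record
    { i = i ; k = k ; z<x = z<x ; x<z = x<z ; z-moved = z-moved
    ; marginal-≤ = begin
        marginal G C t′ i (z i)         ≤⟨ ΔC-transport G (regular i) (<⇒≤pred zi<xi) ⟩
        marginal G C t i (pred (x i))   ≤⟨ cost-≤⇒marginal-≤ G C t i k 0<xi i≢k (x-minimal (move i k x) x′∈B) ⟩
        marginal G C t k (x k)          ≤⟨ ΔC-transport G (regular k) (<⇒≤pred xk<zk) ⟩
        marginal G C t′ k (pred (z k))  ∎ }
    where
    open Exchange ex
    open PosetReasoning (poset G)
    0<xi : 0 < x i
    0<xi = ≤-<-trans z≤n z<x
    i≢k : i ≢ k
    i≢k refl = <-asym z<x x<z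
    x′∈B : InBase f d (move i k x)
    x′∈B = x-moved , trans (x[]-⊤ (move i k x)) (trans (sumℕ-move x i k 0<xi) (inBase-sumℕ f x∈B))

  private
    bound-mono : ∀ {a b c d} → a ≤ b → c ≤ d → 2 * a + c ≤ 2 * b + d
    bound-mono a≤b c≤d = +-mono-≤ (*-monoʳ-≤ 2 a≤b) c≤d

  proximity-≤ : ∀ {t t′ d d′ x} → (∀ e → t e ≤ t′ e) → d ≤ d′ → Optimal G f C t d x → (∃ λ b → InBase f d′ b) →
                ∃ λ y → Optimal G f C t′ d′ y × dist₁ x y ≤ 2 * dist₁ t t′ + ∣ d - d′ ∣
  proximity-≤ {t} {t′} {d} {d′} {x} t≤t′ d≤d′ x-opt@(x∈B , _) feasible =
    descent step (proj₂ (optimal-exists G f C t′ d′ feasible))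
    where
    δ : Fin n → ℕ
    δ e = t′ e ∸ t e
    step : ∀ z → InBase f d′ z → dist₁ x z ≤ 2 * dist₁ t t′ + ∣ d - d′ ∣ ⊎ ImprovingMove t′ x z
    step z z∈B = ⊎.map bounded moving (exchange-or-bounded pm δ (proj₁ x∈B) (proj₁ z∈B) Σx≤Σz)
      where
      Σz≡Σx+c : sumℕ z ≡ sumℕ x + (d′ ∸ d)
      Σz≡Σx+c = inBase-sumℕ-∸ f x∈B z∈B d≤d′
      Σx≤Σz : sumℕ x ≤ sumℕ z
      Σx≤Σz = subst (sumℕ x ≤_) (sym Σz≡Σx+c) (m≤m+n (sumℕ x) (d′ ∸ d))
      bounded : (∀ l → x l ∸ z l ≤ δ l) → dist₁ x z ≤ 2 * dist₁ t t′ + ∣ d - d′ ∣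
      bounded x∸z≤δ = ≤-trans (dist₁-≤ δ Σz≡Σx+c x∸z≤δ)
                              (bound-mono (sumℕ-mono (λ e → n∸m≤∣m-n∣ (t e) (t′ e))) (n∸m≤∣m-n∣ d d′))
      moving : (∃₂ λ i k → Exchange f x z i k × z i + δ i < x i) → ImprovingMove t′ x z
      moving (i , k , ex , zi+δi<xi) =
        improving-move x-opt ex zi+δi<xi (subst (_< z k) (sym (m≤n⇒o+[m∸n]≡o (x k) (t≤t′ k))) (Exchange.x<z ex))

  proximity-≥ : ∀ {t t′ d d′ x} → (∀ e → t′ e ≤ t e) → d′ ≤ d → Optimal G f C t d x → (∃ λ b → InBase f d′ b) →
                ∃ λ y → Optimal G f C t′ d′ y × dist₁ x y ≤ 2 * dist₁ t t′ + ∣ d - d′ ∣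
  proximity-≥ {t} {t′} {d} {d′} {x} t′≤t d′≤d x-opt@(x∈B , _) feasible =
    descent step (proj₂ (optimal-exists G f C t′ d′ feasible))
    where
    δ : Fin n → ℕ
    δ e = t e ∸ t′ e
    step : ∀ z → InBase f d′ z → dist₁ x z ≤ 2 * dist₁ t t′ + ∣ d - d′ ∣ ⊎ ImprovingMove t′ x z
    step z z∈B = ⊎.map bounded moving (exchange-or-bounded pm δ (proj₁ z∈B) (proj₁ x∈B) Σz≤Σx)
      where
      Σx≡Σz+c : sumℕ x ≡ sumℕ z + (d ∸ d′)
      Σx≡Σz+c = inBase-sumℕ-∸ f z∈B x∈B d′≤d
      Σz≤Σx : sumℕ z ≤ sumℕ x
      Σz≤Σx = subst (sumℕ z ≤_) (sym Σx≡Σz+c) (m≤m+n (sumℕ z) (d ∸ d′))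
      bounded : (∀ l → z l ∸ x l ≤ δ l) → dist₁ x z ≤ 2 * dist₁ t t′ + ∣ d - d′ ∣
      bounded z∸x≤δ = ≤-trans (≤-reflexive (dist₁-comm x z)) (≤-trans (dist₁-≤ δ Σx≡Σz+c z∸x≤δ)
                              (bound-mono (sumℕ-mono (λ e → m∸n≤∣m-n∣ (t e) (t′ e))) (m∸n≤∣m-n∣ d d′)))
      moving : (∃₂ λ k i → Exchange f z x k i × x k + δ k < z k) → ImprovingMove t′ x z
      moving (k , i , ex , xk+δk<zk) =
        improving-move x-opt (exchange-sym f ex) (subst (_< x i) (sym (m≤n⇒o+[m∸n]≡o (z i) (t′≤t i))) (Exchange.x<z ex))
                       xk+δk<zk

dist₁-through-meet : ∀ {n} (x y₁ y t t′ : Fin n → ℕ) d d′ →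
  dist₁ x y₁ ≤ 2 * dist₁ t (λ e → t e ⊓ t′ e) + ∣ d - d ⊓ d′ ∣ →
  dist₁ y₁ y ≤ 2 * dist₁ (λ e → t e ⊓ t′ e) t′ + ∣ d ⊓ d′ - d′ ∣ →
  dist₁ x y ≤ 2 * dist₁ t t′ + ∣ d - d′ ∣
dist₁-through-meet x y₁ y t t′ d d′ x~y₁ y₁~y = begin
  dist₁ x y                                     ≤⟨ dist₁-triangle x y₁ y ⟩
  dist₁ x y₁ + dist₁ y₁ y                       ≤⟨ +-mono-≤ x~y₁ y₁~y ⟩
  2 * a + b + (2 * c + e)                       ≡⟨ regroup a b c e ⟩
  2 * (a + c) + (b + e)                         ≡⟨ cong₂ (λ p q → 2 * p + q) (dist₁-⊓ t t′) (∣m-m⊓n∣+∣m⊓n-n∣≡∣m-n∣ d d′) ⟩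
  2 * dist₁ t t′ + ∣ d - d′ ∣                    ∎
  where
  open ≤-Reasoning
  a = dist₁ t (λ e → t e ⊓ t′ e)
  b = ∣ d - d ⊓ d′ ∣
  c = dist₁ (λ e → t e ⊓ t′ e) t′
  e = ∣ d ⊓ d′ - d′ ∣
  regroup : ∀ a b c e → 2 * a + b + (2 * c + e) ≡ 2 * (a + c) + (b + e)
  regroup = solve-∀

theorem3p5 : (G : OrderedAbelianGroup) → (m : ℕ)
    → (f : Subset (suc m) → ℕ) → IsPolymatroid f
    → (C : Fin (suc m) → ℕ → ℕ → OrderedAbelianGroup.Carrier G)
    → (∀ e → NonNeg G (C e)) → (∀ e → Regular G (C e))
    → (D : ℕ → Set) → (∀ d → D d → Σ (Fin (suc m) → ℕ) (InBase f d))
    → ∀ d d' → D d → D d' → (t t' : Fin (suc m) → ℕ)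
    → (x : Fin (suc m) → ℕ) → Optimal G f C t d x
    → Σ (Fin (suc m) → ℕ) (λ x' → Optimal G f C t' d' x'
        × dist₁ x x' ≤ 2 * dist₁ t t' + ∣ d - d' ∣)
theorem3p5 G m f pm C _ regular D feasible d d′ d∈D d′∈D t t′ x x-opt
  with proximity-≥ G pm C regular {t′ = t⊓t′} {d′ = d ⊓ d′} {x} (λ e → m⊓n≤m (t e) (t′ e)) (m⊓n≤m d d′) x-opt feasible-⊓
  where
  t⊓t′ : Fin (suc m) → ℕ
  t⊓t′ e = t e ⊓ t′ e
  feasible-⊓ : Σ (Fin (suc m) → ℕ) (InBase f (d ⊓ d′))
  feasible-⊓ with ⊓-sel d d′
  ... | inj₁ d⊓d′≡d  = subst (λ a → Σ (Fin (suc m) → ℕ) (InBase f a)) (sym d⊓d′≡d) (feasible d d∈D)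
  ... | inj₂ d⊓d′≡d′ = subst (λ a → Σ (Fin (suc m) → ℕ) (InBase f a)) (sym d⊓d′≡d′) (feasible d′ d′∈D)
... | y₁ , y₁-opt , x~y₁
  with proximity-≤ G pm C regular {x = y₁} (λ e → m⊓n≤n (t e) (t′ e)) (m⊓n≤n d d′) y₁-opt (feasible d′ d′∈D)
...   | y , y-opt , y₁~y = y , y-opt , dist₁-through-meet x y₁ y t t′ d d′ x~y₁ y₁~y
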